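{- Let $G$ be a cubic graph and let $F$ be a $2$-factor of $G$. Suppose that the odd cycles of $F$ can be partitioned into pairs $\{C_1,D_1\},\{C_2,D_2\},\ldots,\{C_k,D_k\}$ ($k\ge 0$) such that each pair $\{C_i,D_i\}$ is a good pair. Then $\tau(G)\le 4$; that is, the edge set of $G$ can be covered by at most $4$ perfect matchings.
   Context: For a bridgeless cubic graph $G$, the perfect matching index $\tau(G)$ is the minimum number of perfect matchings of $G$ whose union is $E(G)$. Let $C$ and $C'$ be two distinct odd cycles of a cubic graph $G$. The pair $\{C,C'\}$ is a good pair if there exist three distinct edges $xx'$, $yy'$, $zz'$ of $G$ with $x,y,z$ distinct vertices of $C$ and $x',y',z'$ distinct vertices of $C'$ such that the vertices $x,y,z$ divide $C$ into three edge-disjoint paths each of odd length, and the vertices $x',y',z'$ divide $C'$ into three edge-disjoint paths each of odd length. -}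

module Defs where

open import Data.Nat using (ℕ; zero; suc; _+_; _*_; _∸_; _≤_; _<_)
open import Data.Fin using (Fin; toℕ; fromℕ<)
open import Data.Nat.DivMod using (m%n<n)
open import Data.Empty using (⊥)
open import Data.Bool using (Bool; true)
open import Data.Product using (Σ; ∃; ∃-syntax; _×_; _,_; proj₁; proj₂)
open import Data.Sum using (_⊎_)
open import Data.List using (List; length)
open import Data.List.Relation.Unary.All using (All)
open import Data.List.Relation.Unary.Any using (Any)
open import Relation.Binary.PropositionalEquality using (_≡_; _≢_)
open import Function.Definitions using (Injective)

-- A finite multigraph: vertices Fin n, edges Fin m, each edge has two ends.
record Graph : Set where
  field
    n    : ℕ
    m    : ℕ
    ends : Fin m → Fin n × Fin n

module _ (G : Graph) where
  open Graph G

  Inc : Fin m → Fin n → Set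
  Inc e v = proj₁ (ends e) ≡ v ⊎ proj₂ (ends e) ≡ v

  Joins : Fin m → Fin n → Fin n → Set
  Joins e a b = ends e ≡ (a , b) ⊎ ends e ≡ (b , a)

  Loopless : Set
  Loopless = ∀ e → proj₁ (ends e) ≢ proj₂ (ends e)

  Cubic : Set
  Cubic = Loopless × (∀ v → Σ (Fin m) λ e₁ → Σ (Fin m) λ e₂ → Σ (Fin m) λ e₃ →
            e₁ ≢ e₂ × e₁ ≢ e₃ × e₂ ≢ e₃ × Inc e₁ v × Inc e₂ v × Inc e₃ v ×
            (∀ e → Inc e v → e ≡ e₁ ⊎ e ≡ e₂ ⊎ e ≡ e₃))

  EdgeSet : Set
  EdgeSet = Fin m → Bool

  PerfectMatching : EdgeSet → Set
  PerfectMatching M = ∀ v → Σ (Fin m) λ e → Inc e v × M e ≡ true ×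
                        (∀ e' → Inc e' v → M e' ≡ true → e' ≡ e)

  TwoFactor : EdgeSet → Set
  TwoFactor F = ∀ v → Σ (Fin m) λ e₁ → Σ (Fin m) λ e₂ → e₁ ≢ e₂ ×
                  Inc e₁ v × Inc e₂ v × F e₁ ≡ true × F e₂ ≡ true ×
                  (∀ e → Inc e v → F e ≡ true → e ≡ e₁ ⊎ e ≡ e₂)

  next : {len : ℕ} → Fin len → Fin len
  next {suc k} i = fromℕ< (m%n<n (suc (toℕ i)) (suc k))

  -- a cycle of G (given cyclically by its vertices c 0 .. c (len-1) and
  -- edges d i joining c i and c (i+1 mod len)) all of whose edges lie in F
  record CycleIn (F : EdgeSet) : Set where
    field
      len    : ℕ
      len≥2  : 2 ≤ len
      vtx    : Fin len → Fin n
      edg    : Fin len → Fin m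
      vtx-inj : Injective _≡_ _≡_ vtx
      edg-inj : Injective _≡_ _≡_ edg
      joins  : ∀ i → Joins (edg i) (vtx i) (vtx (next i))
      inF    : ∀ i → F (edg i) ≡ true

  open CycleIn public

  IsOdd : ℕ → Set
  IsOdd k = ∃[ j ] k ≡ suc (2 * j)

  OddCycle : {F : EdgeSet} → CycleIn F → Set
  OddCycle C = IsOdd (len C)

  OnCycle : {F : EdgeSet} → Fin n → CycleIn F → Set
  OnCycle v C = ∃[ i ] vtx C i ≡ v

  VertexDisjoint : {F : EdgeSet} → CycleIn F → CycleIn F → Set
  VertexDisjoint C D = ∀ v → OnCycle v C → OnCycle v D → ⊥

-- positions p < q < r on a cycle of length l cut it into three paths of odd length
SortedOddArcs : (l : ℕ) → ℕ → ℕ → ℕ → Set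
SortedOddArcs l p q r = p < q × q < r × IsOdd' (q ∸ p) × IsOdd' (r ∸ q) × IsOdd' ((l ∸ r) + p)
  where
  IsOdd' : ℕ → Set
  IsOdd' k = ∃[ j ] k ≡ suc (2 * j)

OddArcs : (l : ℕ) → Fin l → Fin l → Fin l → Set
OddArcs l p q r =
  let a = toℕ p ; b = toℕ q ; c = toℕ r in
  SortedOddArcs l a b c ⊎ SortedOddArcs l a c b ⊎ SortedOddArcs l b a c ⊎
  SortedOddArcs l b c a ⊎ SortedOddArcs l c a b ⊎ SortedOddArcs l c b a

module _ (G : Graph) where
  open Graph G

  GoodPair : {F : EdgeSet G} → CycleIn G F → CycleIn G F → Set
  GoodPair C C' =
    OddCycle G C × OddCycle G C' × VertexDisjoint G C C' ×
    Σ (Fin (len C)) λ p → Σ (Fin (len C)) λ q → Σ (Fin (len C)) λ r →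
    Σ (Fin (len C')) λ p' → Σ (Fin (len C')) λ q' → Σ (Fin (len C')) λ r' →
    Σ (Fin m) λ ex → Σ (Fin m) λ ey → Σ (Fin m) λ ez →
      p ≢ q × p ≢ r × q ≢ r × p' ≢ q' × p' ≢ r' × q' ≢ r' ×
      ex ≢ ey × ex ≢ ez × ey ≢ ez ×
      Joins G ex (vtx C p) (vtx C' p') ×
      Joins G ey (vtx C q) (vtx C' q') ×
      Joins G ez (vtx C r) (vtx C' r') ×
      OddArcs (len C) p q r × OddArcs (len C') p' q' r'

  OddCyclesPairedGood : EdgeSet G → Set
  OddCyclesPairedGood F =
    Σ ℕ λ k → Σ (Fin k → CycleIn G F) λ C → Σ (Fin k → CycleIn G F) λ D →
      (∀ i → GoodPair (C i) (D i)) ×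
      -- the 2k cycles are pairwise distinct (hence vertex-disjoint) cycles of F
      (∀ i j → i ≢ j → VertexDisjoint G (C i) (C j)) ×
      (∀ i j → i ≢ j → VertexDisjoint G (D i) (D j)) ×
      (∀ i j → VertexDisjoint G (C i) (D j)) ×
      -- every odd cycle of F is one of them
      (∀ (Z : CycleIn G F) → OddCycle G Z → ∀ v → OnCycle G v Z →
         ∃[ i ] (OnCycle G v (C i) ⊎ OnCycle G v (D i)))

  CoveredBy≤4PM : Set
  CoveredBy≤4PM = Σ (List (EdgeSet G)) λ Ms → length Ms ≤ 4 ×
    All (PerfectMatching G) Ms × (∀ e → Any (λ M → M e ≡ true) Ms)

module Submission where

-- The four matchings are the complement of F (a perfect matching since G is
-- cubic) and, for j = 0, 1, 2, a matching N j built from the j-th rung of every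
-- good pair (C, D).  N j contains that rung and, on C and on D, the cycle edges
-- an odd distance behind its foot; as C and D are odd this matches every vertex
-- of C and D exactly once.  The three feet cut C into odd arcs, so every edge
-- of C lies an odd distance behind some foot and is covered.  All other cycles
-- of F are even; they are properly 2-coloured, and N 0, N 1 take the colour
-- classes (N 2 repeats the first).

open import Data.Bool using (Bool; true; false; not)
open import Data.Bool.Properties using (not-injective) renaming (_≟_ to _≟ᴮ_)
open import Data.Empty using (⊥; ⊥-elim)
open import Data.Fin as Fin using (Fin; toℕ; fromℕ<; fromℕ; inject₁; #_) renaming (_≟_ to _≟ᶠ_; _<_ to _<ᶠ_)
open import Data.Fin.Properties using (toℕ-injective; toℕ-fromℕ<; toℕ-fromℕ; toℕ-inject₁; toℕ<n; pigeonhole; any?; all?)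
open import Data.List using (List; []; _∷_)
open import Data.List.Relation.Unary.All using ([]; _∷_)
open import Data.List.Relation.Unary.Any using (Any; here; there)
open import Data.Nat using (ℕ; zero; suc; _+_; _*_; _∸_; _≤_; _<_; z≤n; s≤s; z<s; parity; _%_; _/_)
open import Data.Nat.DivMod using (m%n<n; m≡m%n+[m/n]*n; m<n⇒m%n≡m; n%n≡0)
open import Data.Nat.Properties
open import Data.Nat.Tactic.RingSolver using (solve-∀)
open import Data.Parity.Base using (Parity; 0ℙ; 1ℙ; _⁻¹) renaming (_+_ to _+ℙ_)
open import Data.Parity.Properties using (p≢p⁻¹; +-homo-+; *-homo-*; suc-homo-⁻¹; ⁻¹-involutive) renaming (_≟_ to _≟ℙ_)
open import Data.Product using (Σ; ∃; ∃-syntax; _×_; _,_; proj₁; proj₂)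
open import Data.Sum using (_⊎_; inj₁; inj₂)
open import Function using (_∘_)
open import Relation.Binary.Definitions using (tri<; tri≈; tri>)
open import Relation.Binary.PropositionalEquality
open import Relation.Nullary using (¬_; Dec; yes; no; does; ¬?)
open import Relation.Nullary.Decidable using (from-yes; dec-true; _→-dec_; _⊎-dec_; _×-dec_; map′)
open import Defs

Odd : ℕ → Set
Odd k = ∃[ j ] k ≡ suc (2 * j)

odd⇒parity≡1ℙ : ∀ {k} → Odd k → parity k ≡ 1ℙ
odd⇒parity≡1ℙ (j , refl) = begin
  parity (suc (2 * j))        ≡⟨ sym (⁻¹-involutive _) ⟩
  parity (suc (2 * j)) ⁻¹ ⁻¹  ≡⟨ cong _⁻¹ (suc-homo-⁻¹ (2 * j)) ⟩
  parity (2 * j) ⁻¹           ≡⟨ cong _⁻¹ (*-homo-* 2 j) ⟩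
  1ℙ                          ∎
  where open ≡-Reasoning

even-or-odd : ∀ k → parity k ≡ 0ℙ ⊎ Odd k
even-or-odd zero = inj₁ refl
even-or-odd (suc zero) = inj₂ (0 , refl)
even-or-odd (suc (suc k)) with even-or-odd k
... | inj₁ even = inj₁ even
... | inj₂ (j , refl) = inj₂ (suc j , cong (suc ∘ suc) (sym (+-suc j (j + 0))))

parity-pred : ∀ {x y} → x ≡ suc y → parity y ≡ parity x ⁻¹
parity-pred {y = y} refl = sym (suc-homo-⁻¹ y)

parity-suc-≢ : ∀ k → parity k ≢ parity (suc k)
parity-suc-≢ k eq = p≢p⁻¹ (parity (suc k)) (trans (sym eq) (sym (suc-homo-⁻¹ k)))

odd-summand : ∀ {X Y D} → X ≡ Y + D → parity D ≡ 1ℙ → parity X ≡ 1ℙ ⊎ parity Y ≡ 1ℙ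
odd-summand {Y = Y} {D} refl pD with parity Y in eY
... | 1ℙ = inj₂ refl
... | 0ℙ = inj₁ (trans (+-homo-+ Y D) (cong₂ _+ℙ_ eY pD))

0ℙ≢1ℙ : 0ℙ ≢ 1ℙ
0ℙ≢1ℙ ()

≢⇒⁻¹ : ∀ {x y : Parity} → x ≢ y → y ≡ x ⁻¹
≢⇒⁻¹ {0ℙ} {0ℙ} x≢y = ⊥-elim (x≢y refl)
≢⇒⁻¹ {0ℙ} {1ℙ} _ = refl
≢⇒⁻¹ {1ℙ} {0ℙ} _ = refl
≢⇒⁻¹ {1ℙ} {1ℙ} x≢y = ⊥-elim (x≢y refl)

no-three-in-two : ∀ {A : Set} {a b x y z : A} →
  (x ≡ a ⊎ x ≡ b) → (y ≡ a ⊎ y ≡ b) → (z ≡ a ⊎ z ≡ b) → x ≢ y → x ≢ z → y ≢ z → ⊥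
no-three-in-two (inj₁ p) (inj₁ q) _        x≢y _   _   = x≢y (trans p (sym q))
no-three-in-two (inj₂ p) (inj₂ q) _        x≢y _   _   = x≢y (trans p (sym q))
no-three-in-two (inj₁ p) (inj₂ _) (inj₁ r) _   x≢z _   = x≢z (trans p (sym r))
no-three-in-two (inj₂ p) (inj₁ _) (inj₂ r) _   x≢z _   = x≢z (trans p (sym r))
no-three-in-two (inj₁ _) (inj₂ q) (inj₂ r) _   _   y≢z = y≢z (trans q (sym r))
no-three-in-two (inj₂ _) (inj₁ q) (inj₁ r) _   _   y≢z = y≢z (trans q (sym r))

fin3-complement : (i j k l : Fin 3) → i ≢ j → k ≢ i → k ≢ j → l ≢ i → l ≢ j → k ≡ l
fin3-complement = from-yes (all? {n = 3}
  {P = λ i → ∀ j k l → i ≢ j → k ≢ i → k ≢ j → l ≢ i → l ≢ j → k ≡ l} λ i →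
  all? λ j → all? λ k → all? λ l →
  ¬? (i ≟ᶠ j) →-dec ¬? (k ≟ᶠ i) →-dec ¬? (k ≟ᶠ j) →-dec ¬? (l ≟ᶠ i) →-dec ¬? (l ≟ᶠ j) →-dec k ≟ᶠ l)

In3 : {A : Set} → A → A → A → A → Set
In3 a b c x = x ≡ a ⊎ x ≡ b ⊎ x ≡ c

module _ {A : Set} {a b c : A} where

  slot : ∀ {x} → In3 a b c x → Fin 3
  slot (inj₁ _) = # 0
  slot (inj₂ (inj₁ _)) = # 1
  slot (inj₂ (inj₂ _)) = # 2

  slot-injective : ∀ {x y} (p : In3 a b c x) (q : In3 a b c y) → slot p ≡ slot q → x ≡ y
  slot-injective (inj₁ p) (inj₁ q) _ = trans p (sym q)
  slot-injective (inj₂ (inj₁ p)) (inj₂ (inj₁ q)) _ = trans p (sym q)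
  slot-injective (inj₂ (inj₂ p)) (inj₂ (inj₂ q)) _ = trans p (sym q)
  slot-injective (inj₁ _) (inj₂ (inj₁ _)) ()
  slot-injective (inj₁ _) (inj₂ (inj₂ _)) ()
  slot-injective (inj₂ (inj₁ _)) (inj₁ _) ()
  slot-injective (inj₂ (inj₁ _)) (inj₂ (inj₂ _)) ()
  slot-injective (inj₂ (inj₂ _)) (inj₁ _) ()
  slot-injective (inj₂ (inj₂ _)) (inj₂ (inj₁ _)) ()

  third-unique : ∀ {x y w w'} → In3 a b c x → In3 a b c y → In3 a b c w → In3 a b c w' →
    x ≢ y → w ≢ x → w ≢ y → w' ≢ x → w' ≢ y → w ≡ w'
  third-unique px py pw pw' x≢y w≢x w≢y w'≢x w'≢y =
    slot-injective pw pw' (fin3-complement (slot px) (slot py) (slot pw) (slot pw')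
      (apart px py x≢y) (apart pw px w≢x) (apart pw py w≢y) (apart pw' px w'≢x) (apart pw' py w'≢y))
    where
    apart : ∀ {u v} (p : In3 a b c u) (q : In3 a b c v) → u ≢ v → slot p ≢ slot q
    apart p q u≢v eq = u≢v (slot-injective p q eq)

least-below : (P : ℕ → Set) → (∀ u → Dec (P u)) → (N : ℕ) →
  (Σ ℕ λ u → u < N × P u × (∀ u' → u' < u → ¬ P u')) ⊎ (∀ u → u < N → ¬ P u)
least-below P P? zero = inj₂ (λ u ())
least-below P P? (suc N) with least-below P P? N
... | inj₁ (u , u<N , pu , least) = inj₁ (u , m<n⇒m<1+n u<N , pu , least)
... | inj₂ none with P? N
...   | yes pN = inj₁ (N , ≤-refl , pN , none)
...   | no ¬pN = inj₂ λ u u<1+N → below-or-at (m<1+n⇒m<n∨m≡n u<1+N)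
  where
  below-or-at : ∀ {u} → u < N ⊎ u ≡ N → ¬ P u
  below-or-at (inj₁ u<N) = none _ u<N
  below-or-at (inj₂ refl) = ¬pN

minimum : ∀ {n} → (ℕ → Fin n) → ℕ → Fin n
minimum f zero = f 0
minimum f (suc k) with toℕ (f (suc k)) ≤? toℕ (minimum f k)
... | yes _ = f (suc k)
... | no _ = minimum f k

minimum-≤ : ∀ {n} (f : ℕ → Fin n) k t → t ≤ k → toℕ (minimum f k) ≤ toℕ (f t)
minimum-≤ f zero .zero z≤n = ≤-refl
minimum-≤ f (suc k) t t≤1+k with toℕ (f (suc k)) ≤? toℕ (minimum f k) | m≤n⇒m<n∨m≡n t≤1+k
... | yes _     | inj₂ refl = ≤-refl
... | yes new≤  | inj₁ (s≤s t≤k) = ≤-trans new≤ (minimum-≤ f k t t≤k)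
... | no new≰   | inj₂ refl = <⇒≤ (≰⇒> new≰)
... | no _      | inj₁ (s≤s t≤k) = minimum-≤ f k t t≤k

minimum-attained : ∀ {n} (f : ℕ → Fin n) k → ∃ λ t → minimum f k ≡ f t
minimum-attained f zero = 0 , refl
minimum-attained f (suc k) with toℕ (f (suc k)) ≤? toℕ (minimum f k)
... | yes _ = suc k , refl
... | no _ = minimum-attained f k

gap : ℕ → ℕ → ℕ → ℕ
gap L p t with p ≤? t
... | yes _ = t ∸ p
... | no _ = t + L ∸ p

gap-≤ : ∀ L p t → p ≤ t → gap L p t ≡ t ∸ p
gap-≤ L p t p≤t with p ≤? t
... | yes _ = refl
... | no p≰t = ⊥-elim (p≰t p≤t)

gap-≰ : ∀ L p t → ¬ p ≤ t → gap L p t ≡ t + L ∸ p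
gap-≰ L p t p≰t with p ≤? t
... | yes p≤t = ⊥-elim (p≰t p≤t)
... | no _ = refl

gap-self : ∀ L p → parity (gap L p p) ≡ 0ℙ
gap-self L p = cong parity (trans (gap-≤ L p p ≤-refl) (n∸n≡0 p))

-- Positions on a cycle.  The successor 'next' is defined in Defs relative to
-- a graph, although it does not depend on it.
module Cyclic (G : Graph) where

  next-cases : ∀ {L} (i : Fin L) →
    (suc (toℕ i) < L × toℕ (next G i) ≡ suc (toℕ i)) ⊎ (suc (toℕ i) ≡ L × toℕ (next G i) ≡ 0)
  next-cases {suc k} i with m≤n⇒m<n∨m≡n (toℕ<n i)
  ... | inj₁ lt = inj₁ (lt , trans (toℕ-fromℕ< (m%n<n (suc (toℕ i)) (suc k))) (m<n⇒m%n≡m lt))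
  ... | inj₂ eq = inj₂ (eq , trans (toℕ-fromℕ< (m%n<n (suc (toℕ i)) (suc k)))
                                   (trans (cong (_% suc k) eq) (n%n≡0 (suc k))))

  prev : ∀ {L} → Fin L → Fin L
  prev {suc k} Fin.zero = fromℕ k
  prev {suc k} (Fin.suc i) = inject₁ i

  next-prev : ∀ {L} (s : Fin L) → next G (prev s) ≡ s
  next-prev {suc k} Fin.zero with next-cases {suc k} (fromℕ k)
  ... | inj₁ (lt , _) = ⊥-elim (<-irrefl refl (subst (λ z → suc z < suc k) (toℕ-fromℕ k) lt))
  ... | inj₂ (_ , e) = toℕ-injective e
  next-prev {suc k} (Fin.suc i) with next-cases {suc k} (inject₁ i)
  ... | inj₁ (_ , e) = toℕ-injective (trans e (cong suc (toℕ-inject₁ i)))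
  ... | inj₂ (e , _) = ⊥-elim (<-irrefl (trans (sym (cong suc (toℕ-inject₁ i))) e) (toℕ<n (Fin.suc i)))

  next-injective : ∀ {L} (a b : Fin L) → next G a ≡ next G b → a ≡ b
  next-injective a b eq with next-cases a | next-cases b
  ... | inj₁ (_ , ea) | inj₁ (_ , eb) = toℕ-injective (suc-injective (trans (sym ea) (trans (cong toℕ eq) eb)))
  ... | inj₂ (ea , _) | inj₂ (eb , _) = toℕ-injective (suc-injective (trans ea (sym eb)))
  ... | inj₁ (_ , ea) | inj₂ (_ , eb) = ⊥-elim (1+n≢0 (trans (sym ea) (trans (cong toℕ eq) eb)))
  ... | inj₂ (_ , ea) | inj₁ (_ , eb) = ⊥-elim (1+n≢0 (trans (sym eb) (trans (cong toℕ (sym eq)) ea)))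

  prev-next : ∀ {L} (t : Fin L) → prev (next G t) ≡ t
  prev-next t = next-injective _ _ (next-prev (next G t))

  prev≢ : ∀ {L} → 2 ≤ L → (s : Fin L) → prev s ≢ s
  prev≢ {L} 2≤L s eq = by-cases (next-cases s)
    where
    s≡next : s ≡ next G s
    s≡next = trans (sym (next-prev s)) (cong (next G) eq)
    by-cases : (suc (toℕ s) < L × toℕ (next G s) ≡ suc (toℕ s)) ⊎ (suc (toℕ s) ≡ L × toℕ (next G s) ≡ 0) → ⊥
    by-cases (inj₁ (_ , e)) = <-irrefl (trans (cong toℕ s≡next) e) (n<1+n (toℕ s))
    by-cases (inj₂ (L≡ , e)) = <-irrefl refl (subst (2 ≤_) (trans (sym L≡) (cong suc (trans (cong toℕ s≡next) e))) 2≤L)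

  gap-to-prev : ∀ {L} → parity L ≡ 1ℙ → (p : Fin L) → parity (gap L (toℕ p) (toℕ (prev p))) ≡ 0ℙ
  gap-to-prev {suc k} pL p = trans (cong parity (gap-prev≡ p)) (trans (sym (suc-homo-⁻¹ k)) (cong _⁻¹ pL))
    where
    gap-prev≡ : (p : Fin (suc k)) → gap (suc k) (toℕ p) (toℕ (prev p)) ≡ k
    gap-prev≡ Fin.zero = trans (cong (gap (suc k) 0) (toℕ-fromℕ k)) (gap-≤ (suc k) 0 k z≤n)
    gap-prev≡ (Fin.suc i) = begin
      gap (suc k) (suc (toℕ i)) (toℕ (inject₁ i)) ≡⟨ cong (gap (suc k) (suc (toℕ i))) (toℕ-inject₁ i) ⟩
      gap (suc k) (suc (toℕ i)) (toℕ i)           ≡⟨ gap-≰ (suc k) (suc (toℕ i)) (toℕ i) (<-irrefl refl) ⟩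
      toℕ i + suc k ∸ suc (toℕ i)                 ≡⟨ cong (_∸ suc (toℕ i)) (+-suc (toℕ i) k) ⟩
      suc (toℕ i) + k ∸ suc (toℕ i)               ≡⟨ m+n∸m≡n (suc (toℕ i)) k ⟩
      k                                           ∎
      where open ≡-Reasoning

  gap-prev : ∀ {L} (s p : Fin L) → s ≢ p →
    parity (gap L (toℕ p) (toℕ (prev s))) ≡ parity (gap L (toℕ p) (toℕ s)) ⁻¹
  gap-prev {suc k} Fin.zero p s≢p with toℕ p ≟ 0
  ... | yes p≡0 = ⊥-elim (s≢p (toℕ-injective (sym p≡0)))
  ... | no p≢0 = parity-pred (begin
      gap (suc k) (toℕ p) 0       ≡⟨ gap-≰ (suc k) (toℕ p) 0 (p≢0 ∘ n≤0⇒n≡0) ⟩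
      suc k ∸ toℕ p               ≡⟨ +-∸-assoc 1 p≤k ⟩
      suc (k ∸ toℕ p)             ≡⟨ cong suc (sym (gap-≤ (suc k) (toℕ p) k p≤k)) ⟩
      suc (gap (suc k) (toℕ p) k) ≡⟨ cong (suc ∘ gap (suc k) (toℕ p)) (sym (toℕ-fromℕ k)) ⟩
      suc (gap (suc k) (toℕ p) (toℕ (fromℕ k))) ∎)
    where
    open ≡-Reasoning
    p≤k : toℕ p ≤ k
    p≤k = ≤-pred (toℕ<n p)
  gap-prev {suc k} (Fin.suc i) p s≢p with toℕ p ≤? toℕ i
  ... | yes p≤i = parity-pred (begin
      gap (suc k) (toℕ p) (suc (toℕ i))  ≡⟨ gap-≤ (suc k) (toℕ p) (suc (toℕ i)) (m≤n⇒m≤1+n p≤i) ⟩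
      suc (toℕ i) ∸ toℕ p                ≡⟨ +-∸-assoc 1 p≤i ⟩
      suc (toℕ i ∸ toℕ p)                ≡⟨ cong suc (sym (gap-≤ (suc k) (toℕ p) (toℕ i) p≤i)) ⟩
      suc (gap (suc k) (toℕ p) (toℕ i))  ≡⟨ cong (suc ∘ gap (suc k) (toℕ p)) (sym (toℕ-inject₁ i)) ⟩
      suc (gap (suc k) (toℕ p) (toℕ (inject₁ i))) ∎)
    where open ≡-Reasoning
  ... | no p≰i = parity-pred (begin
      gap (suc k) (toℕ p) (suc (toℕ i))   ≡⟨ gap-≰ (suc k) (toℕ p) (suc (toℕ i)) p≰1+i ⟩
      suc (toℕ i) + suc k ∸ toℕ p         ≡⟨ +-∸-assoc 1 p≤i+L ⟩
      suc (toℕ i + suc k ∸ toℕ p)         ≡⟨ cong suc (sym (gap-≰ (suc k) (toℕ p) (toℕ i) p≰i)) ⟩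
      suc (gap (suc k) (toℕ p) (toℕ i))   ≡⟨ cong (suc ∘ gap (suc k) (toℕ p)) (sym (toℕ-inject₁ i)) ⟩
      suc (gap (suc k) (toℕ p) (toℕ (inject₁ i))) ∎)
    where
    open ≡-Reasoning
    p≰1+i : ¬ toℕ p ≤ suc (toℕ i)
    p≰1+i p≤1+i with m≤n⇒m<n∨m≡n p≤1+i
    ... | inj₁ p<1+i = p≰i (≤-pred p<1+i)
    ... | inj₂ p≡1+i = s≢p (toℕ-injective (sym p≡1+i))
    p≤i+L : toℕ p ≤ toℕ i + suc k
    p≤i+L = ≤-trans (<⇒≤ (toℕ<n p)) (m≤n+m (suc k) (toℕ i))

∸-split : ∀ {a b X} → a ≤ b → b ≤ X → X ∸ a ≡ (X ∸ b) + (b ∸ a)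
∸-split {a} {b} {X} a≤b b≤X = trans (cong (_∸ a) (sym (m∸n+n≡m b≤X))) (+-∸-assoc (X ∸ b) a≤b)

-- If a < b < c cut a cycle of length L into three odd arcs, then for every
-- position t one of a, b, c lies an odd distance behind t: the distances from
-- two consecutive cut points differ by the odd length of the arc between them.
odd-gap-sorted : ∀ L a b c t → c < L → SortedOddArcs L a b c →
  parity (gap L a t) ≡ 1ℙ ⊎ parity (gap L b t) ≡ 1ℙ ⊎ parity (gap L c t) ≡ 1ℙ
odd-gap-sorted L a b c t c<L (a<b , b<c , ab-odd , bc-odd , ca-odd) with t <? a
... | yes t<a = left (odd-summand {Y = gap L b t} split (odd⇒parity≡1ℙ ab-odd))
  where
  b≤t+L : b ≤ t + L
  b≤t+L = ≤-trans (<⇒≤ (<-trans b<c c<L)) (m≤n+m L t)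
  split : gap L a t ≡ gap L b t + (b ∸ a)
  split = trans (gap-≰ L a t (<⇒≱ t<a)) (trans (∸-split (<⇒≤ a<b) b≤t+L)
            (cong (_+ (b ∸ a)) (sym (gap-≰ L b t (<⇒≱ (<-trans t<a a<b))))))
  left : parity (gap L a t) ≡ 1ℙ ⊎ parity (gap L b t) ≡ 1ℙ → _
  left (inj₁ x) = inj₁ x
  left (inj₂ x) = inj₂ (inj₁ x)
... | no t≮a with t <? c | t <? b
...   | no t≮c | _ = right (odd-summand {Y = gap L c t} split (odd⇒parity≡1ℙ bc-odd))
  where
  b≤t : b ≤ t
  b≤t = ≤-trans (<⇒≤ b<c) (≮⇒≥ t≮c)
  split : gap L b t ≡ gap L c t + (c ∸ b)
  split = trans (gap-≤ L b t b≤t) (trans (∸-split (<⇒≤ b<c) (≮⇒≥ t≮c))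
            (cong (_+ (c ∸ b)) (sym (gap-≤ L c t (≮⇒≥ t≮c)))))
  right : parity (gap L b t) ≡ 1ℙ ⊎ parity (gap L c t) ≡ 1ℙ → _
  right (inj₁ x) = inj₂ (inj₁ x)
  right (inj₂ x) = inj₂ (inj₂ x)
...   | yes t<c | yes t<b = around (odd-summand {Y = gap L a t} split (odd⇒parity≡1ℙ ca-odd))
  where
  a≤t : a ≤ t
  a≤t = ≮⇒≥ t≮a
  split : gap L c t ≡ gap L a t + ((L ∸ c) + a)
  split = begin
    gap L c t                 ≡⟨ gap-≰ L c t (<⇒≱ t<c) ⟩
    t + L ∸ c                 ≡⟨ cong (λ z → z + L ∸ c) (sym (m∸n+n≡m a≤t)) ⟩
    t ∸ a + a + L ∸ c         ≡⟨ cong (_∸ c) (+-assoc (t ∸ a) a L) ⟩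
    t ∸ a + (a + L) ∸ c       ≡⟨ +-∸-assoc (t ∸ a) (≤-trans (<⇒≤ c<L) (m≤n+m L a)) ⟩
    t ∸ a + (a + L ∸ c)       ≡⟨ cong₂ _+_ (sym (gap-≤ L a t a≤t)) (+-∸-assoc a (<⇒≤ c<L)) ⟩
    gap L a t + (a + (L ∸ c)) ≡⟨ cong (gap L a t +_) (+-comm a (L ∸ c)) ⟩
    gap L a t + ((L ∸ c) + a) ∎
    where open ≡-Reasoning
  around : parity (gap L c t) ≡ 1ℙ ⊎ parity (gap L a t) ≡ 1ℙ → _
  around (inj₁ x) = inj₂ (inj₂ x)
  around (inj₂ x) = inj₁ x
...   | yes t<c | no t≮b = left (odd-summand {Y = gap L b t} split (odd⇒parity≡1ℙ ab-odd))
  where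
  split : gap L a t ≡ gap L b t + (b ∸ a)
  split = trans (gap-≤ L a t (≮⇒≥ t≮a)) (trans (∸-split (<⇒≤ a<b) (≮⇒≥ t≮b))
            (cong (_+ (b ∸ a)) (sym (gap-≤ L b t (≮⇒≥ t≮b)))))
  left : parity (gap L a t) ≡ 1ℙ ⊎ parity (gap L b t) ≡ 1ℙ → _
  left (inj₁ x) = inj₁ x
  left (inj₂ x) = inj₂ (inj₁ x)

odd-gap : ∀ L (pos : Fin 3 → Fin L) → OddArcs L (pos (# 0)) (pos (# 1)) (pos (# 2)) →
  (t : Fin L) → ∃ λ j → parity (gap L (toℕ (pos j)) (toℕ t)) ≡ 1ℙ
odd-gap L pos arcs t = by-order arcs
  where
  Result : Set
  Result = ∃ λ j → parity (gap L (toℕ (pos j)) (toℕ t)) ≡ 1ℙ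
  via : ∀ i j k → SortedOddArcs L (toℕ (pos i)) (toℕ (pos j)) (toℕ (pos k)) → Result
  via i j k s with odd-gap-sorted L _ _ _ (toℕ t) (toℕ<n (pos k)) s
  ... | inj₁ x = i , x
  ... | inj₂ (inj₁ x) = j , x
  ... | inj₂ (inj₂ x) = k , x
  by-order : OddArcs L (pos (# 0)) (pos (# 1)) (pos (# 2)) → Result
  by-order (inj₁ s)                             = via (# 0) (# 1) (# 2) s
  by-order (inj₂ (inj₁ s))                      = via (# 0) (# 2) (# 1) s
  by-order (inj₂ (inj₂ (inj₁ s)))               = via (# 1) (# 0) (# 2) s
  by-order (inj₂ (inj₂ (inj₂ (inj₁ s))))        = via (# 1) (# 2) (# 0) s
  by-order (inj₂ (inj₂ (inj₂ (inj₂ (inj₁ s))))) = via (# 2) (# 0) (# 1) s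
  by-order (inj₂ (inj₂ (inj₂ (inj₂ (inj₂ s))))) = via (# 2) (# 1) (# 0) s

module Incidence (G : Graph) (loopless : Loopless G) where
  open Graph G

  joins-inc₁ : ∀ {e a b} → Joins G e a b → Inc G e a
  joins-inc₁ (inj₁ p) = inj₁ (cong proj₁ p)
  joins-inc₁ (inj₂ p) = inj₂ (cong proj₂ p)

  joins-inc₂ : ∀ {e a b} → Joins G e a b → Inc G e b
  joins-inc₂ (inj₁ p) = inj₂ (cong proj₂ p)
  joins-inc₂ (inj₂ p) = inj₁ (cong proj₁ p)

  joins-sym : ∀ {e a b} → Joins G e a b → Joins G e b a
  joins-sym (inj₁ p) = inj₂ p
  joins-sym (inj₂ p) = inj₁ p

  joins-≢ : ∀ {e a b} → Joins G e a b → a ≢ b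
  joins-≢ {e} (inj₁ p) a≡b = loopless e (trans (cong proj₁ p) (trans a≡b (sym (cong proj₂ p))))
  joins-≢ {e} (inj₂ p) a≡b = loopless e (trans (cong proj₁ p) (trans (sym a≡b) (sym (cong proj₂ p))))

  joins-unique : ∀ {e a b c} → Joins G e a b → Joins G e a c → b ≡ c
  joins-unique (inj₁ p) (inj₁ q) = cong proj₂ (trans (sym p) q)
  joins-unique (inj₂ p) (inj₂ q) = cong proj₁ (trans (sym p) q)
  joins-unique {e} (inj₁ p) (inj₂ q) = ⊥-elim (loopless e (trans (cong proj₁ p) (sym (cong proj₂ q))))
  joins-unique {e} (inj₂ p) (inj₁ q) = ⊥-elim (loopless e (trans (cong proj₁ q) (sym (cong proj₂ p))))

  joins-ends : ∀ {e a b v} → Joins G e a b → Inc G e v → v ≡ a ⊎ v ≡ b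
  joins-ends (inj₁ p) (inj₁ q) = inj₁ (trans (sym q) (cong proj₁ p))
  joins-ends (inj₁ p) (inj₂ q) = inj₂ (trans (sym q) (cong proj₂ p))
  joins-ends (inj₂ p) (inj₁ q) = inj₂ (trans (sym q) (cong proj₁ p))
  joins-ends (inj₂ p) (inj₂ q) = inj₁ (trans (sym q) (cong proj₂ p))

  other : Fin m → Fin n → Fin n
  other e v with proj₁ (ends e) ≟ᶠ v
  ... | yes _ = proj₂ (ends e)
  ... | no _ = proj₁ (ends e)

  other-joins : ∀ {e v} → Inc G e v → Joins G e v (other e v)
  other-joins {e} {v} i with proj₁ (ends e) ≟ᶠ v
  ... | yes p = inj₁ (cong₂ _,_ p refl)
  other-joins {e} {v} (inj₁ q) | no ¬p = ⊥-elim (¬p q)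
  other-joins {e} {v} (inj₂ q) | no _ = inj₂ (cong₂ _,_ refl q)

  other-inc : ∀ {e v} → Inc G e v → Inc G e (other e v)
  other-inc i = joins-inc₂ (other-joins i)

  other-other : ∀ {e v} → Inc G e v → other e (other e v) ≡ v
  other-other i = joins-unique (other-joins (other-inc i)) (joins-sym (other-joins i))

  other-≢ : ∀ {e v} → Inc G e v → other e v ≢ v
  other-≢ i eq = joins-≢ (other-joins i) (sym eq)

-- A dart (w, g) is a vertex w
-- together with an F-edge g at w; a step crosses g and continues along the
-- other F-edge at its far end.
module TwoFactorWalk (G : Graph) (loopless : Loopless G) (F : EdgeSet G) (two-factor : TwoFactor G F) where
  open Graph G
  open Incidence G loopless

  f₁ f₂ : Fin n → Fin m
  f₁ v = proj₁ (two-factor v)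
  f₂ v = proj₁ (proj₂ (two-factor v))

  f₁≢f₂ : ∀ v → f₁ v ≢ f₂ v
  f₁≢f₂ v = proj₁ (proj₂ (proj₂ (two-factor v)))

  f₁-inc : ∀ v → Inc G (f₁ v) v
  f₁-inc v = proj₁ (proj₂ (proj₂ (proj₂ (two-factor v))))

  f₂-inc : ∀ v → Inc G (f₂ v) v
  f₂-inc v = proj₁ (proj₂ (proj₂ (proj₂ (proj₂ (two-factor v)))))

  f₁-F : ∀ v → F (f₁ v) ≡ true
  f₁-F v = proj₁ (proj₂ (proj₂ (proj₂ (proj₂ (proj₂ (two-factor v))))))

  f₂-F : ∀ v → F (f₂ v) ≡ true
  f₂-F v = proj₁ (proj₂ (proj₂ (proj₂ (proj₂ (proj₂ (proj₂ (two-factor v)))))))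

  F-edge-at : ∀ {e v} → Inc G e v → F e ≡ true → e ≡ f₁ v ⊎ e ≡ f₂ v
  F-edge-at {e} {v} = proj₂ (proj₂ (proj₂ (proj₂ (proj₂ (proj₂ (proj₂ (two-factor v))))))) e

  F-edges-at : ∀ {x y e v} → x ≢ y → Inc G x v → F x ≡ true → Inc G y v → F y ≡ true →
               Inc G e v → F e ≡ true → e ≡ x ⊎ e ≡ y
  F-edges-at {x} {y} {e} x≢y ix fx iy fy ie fe with e ≟ᶠ x | e ≟ᶠ y
  ... | yes e≡x | _ = inj₁ e≡x
  ... | no _ | yes e≡y = inj₂ e≡y
  ... | no e≢x | no e≢y = ⊥-elim (no-three-in-two (F-edge-at ix fx) (F-edge-at iy fy) (F-edge-at ie fe)
                                    x≢y (e≢x ∘ sym) (e≢y ∘ sym))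

  turn : Fin n → Fin m → Fin m
  turn w g with g ≟ᶠ f₁ w
  ... | yes _ = f₂ w
  ... | no _ = f₁ w

  turn-inc : ∀ w g → Inc G (turn w g) w
  turn-inc w g with g ≟ᶠ f₁ w
  ... | yes _ = f₂-inc w
  ... | no _ = f₁-inc w

  turn-F : ∀ w g → F (turn w g) ≡ true
  turn-F w g with g ≟ᶠ f₁ w
  ... | yes _ = f₂-F w
  ... | no _ = f₁-F w

  turn-≢ : ∀ w g → turn w g ≢ g
  turn-≢ w g with g ≟ᶠ f₁ w
  ... | yes g≡f₁ = λ f₂≡g → f₁≢f₂ w (trans (sym g≡f₁) (sym f₂≡g))
  ... | no g≢f₁ = λ f₁≡g → g≢f₁ (sym f₁≡g)

  -- turning twice at w undoes the turn: turn w g and g are the two F-edges at w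
  turn-turn : ∀ {w g} → Inc G g w → F g ≡ true → turn w (turn w g) ≡ g
  turn-turn {w} {g} ig fg with F-edges-at (turn-≢ w g ∘ sym) ig fg (turn-inc w g) (turn-F w g)
                                 (turn-inc w (turn w g)) (turn-F w (turn w g))
  ... | inj₁ back = back
  ... | inj₂ same = ⊥-elim (turn-≢ w (turn w g) same)

  Dart : Set
  Dart = Fin n × Fin m

  Valid : Dart → Set
  Valid (w , g) = Inc G g w × F g ≡ true

  step : Dart → Dart
  step (w , g) = other g w , turn (other g w) g

  step-valid : ∀ x → Valid x → Valid (step x)
  step-valid (w , g) _ = turn-inc (other g w) g , turn-F (other g w) g

  reverse : Dart → Dart
  reverse (w , g) = other g w , g

  step-reverse-step : ∀ x → Valid x → step (reverse (step x)) ≡ reverse x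
  step-reverse-step (w , g) (ig , fg) =
    cong₂ _,_ back-at-w′ (trans (cong (λ z → turn z g′) back-at-w′) (turn-turn (other-inc ig) fg))
    where
    w′ : Fin n
    w′ = other g w
    g′ : Fin m
    g′ = turn w′ g
    back-at-w′ : other g′ (other g′ w′) ≡ w′
    back-at-w′ = other-other (turn-inc w′ g)

  walk : Dart → ℕ → Dart
  walk x zero = x
  walk x (suc t) = step (walk x t)

  walk-+ : ∀ x a b → walk (walk x a) b ≡ walk x (b + a)
  walk-+ x a zero = refl
  walk-+ x a (suc b) = cong step (walk-+ x a b)

  walk-valid : ∀ x → Valid x → ∀ t → Valid (walk x t)
  walk-valid x vx zero = vx
  walk-valid x vx (suc t) = step-valid _ (walk-valid x vx t)

  Visits : Dart → Fin n → Set
  Visits x z = ∃ λ t → proj₁ (walk x t) ≡ z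

  module Orbit (x₀ : Dart) (valid₀ : Valid x₀) where
    vertexAt : ℕ → Fin n
    vertexAt t = proj₁ (walk x₀ t)

    edgeAt : ℕ → Fin m
    edgeAt t = proj₂ (walk x₀ t)

    edgeAt-inc : ∀ t → Inc G (edgeAt t) (vertexAt t)
    edgeAt-inc t = proj₁ (walk-valid x₀ valid₀ t)

    edgeAt-F : ∀ t → F (edgeAt t) ≡ true
    edgeAt-F t = proj₂ (walk-valid x₀ valid₀ t)

    edgeAt-joins : ∀ t → Joins G (edgeAt t) (vertexAt t) (vertexAt (suc t))
    edgeAt-joins t = other-joins (edgeAt-inc t)

    edgeAt-inc⁺ : ∀ t → Inc G (edgeAt t) (vertexAt (suc t))
    edgeAt-inc⁺ t = joins-inc₂ (edgeAt-joins t)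

    edgeAt-back : ∀ t → other (edgeAt t) (vertexAt (suc t)) ≡ vertexAt t
    edgeAt-back t = other-other (edgeAt-inc t)

    edgeAt-suc-≢ : ∀ t → edgeAt (suc t) ≢ edgeAt t
    edgeAt-suc-≢ t = turn-≢ (vertexAt (suc t)) (edgeAt t)

    vertexAt-suc-≢ : ∀ t → vertexAt (suc t) ≢ vertexAt t
    vertexAt-suc-≢ t = other-≢ (edgeAt-inc t)

    F-edges-after : ∀ t {e} → Inc G e (vertexAt (suc t)) → F e ≡ true → e ≡ edgeAt t ⊎ e ≡ edgeAt (suc t)
    F-edges-after t = F-edges-at (edgeAt-suc-≢ t ∘ sym) (edgeAt-inc⁺ t) (edgeAt-F t)
                        (edgeAt-inc (suc t)) (edgeAt-F (suc t))

    DistinctBelow : ℕ → Set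
    DistinctBelow T = ∀ a b → a < T → b < T → vertexAt a ≡ vertexAt b → a ≡ b

    -- While the vertices 0, …, T₀ are distinct, vertex T₀ + 1 cannot repeat an
    -- inner vertex s + 1 ≤ T₀: both F-edges there are already used by the walk.
    no-inner-return : ∀ T₀ → DistinctBelow (suc T₀) → ∀ s → suc s < suc T₀ →
                      vertexAt (suc T₀) ≡ vertexAt (suc s) → ⊥
    no-inner-return T₀ distinct s s<T₀ eq
      with F-edges-after s (subst (Inc G (edgeAt T₀)) eq (edgeAt-inc⁺ T₀)) (edgeAt-F T₀)
    ... | inj₁ same-edge = <-irrefl (cong suc (sym T₀≡s)) s<T₀
      where
      T₀≡s : T₀ ≡ s
      T₀≡s = distinct T₀ s ≤-refl (<-trans (n<1+n s) s<T₀)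
               (trans (sym (edgeAt-back T₀)) (trans (cong₂ other same-edge eq) (edgeAt-back s)))
    ... | inj₂ next-edge with m≤n⇒m<n∨m≡n s<T₀
    ...   | inj₁ s+2≤T₀ = edgeAt-suc-≢ (suc s) (trans (cong edgeAt (sym T₀≡s+2)) next-edge)
      where
      T₀≡s+2 : T₀ ≡ suc (suc s)
      T₀≡s+2 = distinct T₀ (suc (suc s)) ≤-refl s+2≤T₀
                 (trans (sym (edgeAt-back T₀)) (cong₂ other next-edge eq))
    ...   | inj₂ s+1≡T₀ = vertexAt-suc-≢ (suc s) (trans (cong vertexAt s+1≡T₀) eq)

    distinct-extend : ∀ t → DistinctBelow t → (∀ a → a < t → vertexAt a ≢ vertexAt t) → DistinctBelow (suc t)
    distinct-extend t distinct new a b a<1+t b<1+t eq with m<1+n⇒m<n∨m≡n a<1+t | m<1+n⇒m<n∨m≡n b<1+t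
    ... | inj₁ a<t  | inj₁ b<t  = distinct a b a<t b<t eq
    ... | inj₁ a<t  | inj₂ refl = ⊥-elim (new a a<t eq)
    ... | inj₂ refl | inj₁ b<t  = ⊥-elim (new b b<t (sym eq))
    ... | inj₂ refl | inj₂ refl = refl

    distinct-until-return : ∀ t → (∀ u → u < t → vertexAt (suc u) ≢ vertexAt 0) → DistinctBelow (suc t)
    distinct-until-return zero _ a b (s≤s z≤n) (s≤s z≤n) _ = refl
    distinct-until-return (suc t) no-return = distinct-extend (suc t) distinct new
      where
      distinct : DistinctBelow (suc t)
      distinct = distinct-until-return t (λ u u<t → no-return u (m<n⇒m<1+n u<t))
      new : ∀ a → a < suc t → vertexAt a ≢ vertexAt (suc t)
      new zero _ eq = no-return t ≤-refl (sym eq)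
      new (suc a) a<1+t eq = no-inner-return t distinct a a<1+t (sym eq)

    abstract
      first-return : Σ ℕ λ u₀ → u₀ < n × vertexAt (suc u₀) ≡ vertexAt 0 ×
                       (∀ u → u < u₀ → vertexAt (suc u) ≢ vertexAt 0)
      first-return with least-below (λ u → vertexAt (suc u) ≡ vertexAt 0) (λ u → vertexAt (suc u) ≟ᶠ vertexAt 0) n
      ... | inj₁ found = found
      ... | inj₂ none = ⊥-elim (collision (pigeonhole ≤-refl first-n+1))
        where
        first-n+1 : Fin (suc n) → Fin n
        first-n+1 i = vertexAt (toℕ i)
        collision : (∃ λ (i : Fin (suc n)) → ∃ λ j → i <ᶠ j × first-n+1 i ≡ first-n+1 j) → ⊥
        collision (i , j , i<j , eq) = <-irrefl (distinct-until-return n none _ _ (toℕ<n i) (toℕ<n j) eq) i<j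

    T : ℕ
    T = suc (proj₁ first-return)

    T≤n : T ≤ n
    T≤n = proj₁ (proj₂ first-return)

    returns : vertexAt T ≡ vertexAt 0
    returns = proj₁ (proj₂ (proj₂ first-return))

    distinct : DistinctBelow T
    distinct = distinct-until-return _ (proj₂ (proj₂ (proj₂ first-return)))

    1<T : 1 < T
    1<T = s≤s (n≢0⇒n>0 (λ eq → vertexAt-suc-≢ 0 (trans (cong (vertexAt ∘ suc) (sym eq)) returns)))

    edge-returns : edgeAt T ≡ edgeAt 0
    edge-returns with F-edges-after (T ∸ 1) (subst (Inc G (edgeAt 0)) (sym returns) (edgeAt-inc 0)) (edgeAt-F 0)
    ... | inj₂ e₀≡e_T = sym e₀≡e_T
    ... | inj₁ e₀≡e_T-1 = ⊥-elim (edgeAt-suc-≢ 0 (sym (trans e₀≡e_T-1 (cong edgeAt T-1≡1))))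
      where
      T-1≡1 : T ∸ 1 ≡ 1
      T-1≡1 = distinct (T ∸ 1) 1 ≤-refl 1<T
                (trans (sym (edgeAt-back (T ∸ 1))) (cong₂ other (sym e₀≡e_T-1) returns))

    walk-T : walk x₀ T ≡ x₀
    walk-T = cong₂ _,_ returns edge-returns

    walk-periodic : ∀ k a → walk x₀ (a + k * T) ≡ walk x₀ a
    walk-periodic zero a = cong (walk x₀) (+-identityʳ a)
    walk-periodic (suc k) a = begin
      walk x₀ (a + suc k * T)          ≡⟨ cong (walk x₀) (trans (cong (a +_) (+-comm T (k * T))) (sym (+-assoc a (k * T) T))) ⟩
      walk x₀ (a + k * T + T)          ≡⟨ sym (walk-+ x₀ T (a + k * T)) ⟩
      walk (walk x₀ T) (a + k * T)     ≡⟨ cong (λ z → walk z (a + k * T)) walk-T ⟩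
      walk x₀ (a + k * T)              ≡⟨ walk-periodic k a ⟩
      walk x₀ a                        ∎
      where open ≡-Reasoning

    walk-mod : ∀ a → walk x₀ a ≡ walk x₀ (a % T)
    walk-mod a = trans (cong (walk x₀) (m≡m%n+[m/n]*n a T)) (walk-periodic (a / T) (a % T))

    no-edge-repeat : ∀ a b → a < b → b < T → edgeAt a ≡ edgeAt b → ⊥
    no-edge-repeat a b a<b b<T eq
      with joins-ends (edgeAt-joins b) (subst (λ z → Inc G z (vertexAt a)) eq (edgeAt-inc a))
    ... | inj₁ va≡vb = <⇒≢ a<b (distinct a b (<-trans a<b b<T) b<T va≡vb)
    ... | inj₂ va≡vb+1 with m≤n⇒m<n∨m≡n b<T
    ...   | inj₁ b+1<T = <-asym a<b (subst (b <_) (sym (distinct a (suc b) (<-trans a<b b<T) b+1<T va≡vb+1)) ≤-refl)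
    ...   | inj₂ b+1≡T with distinct a 0 (<-trans a<b b<T) (<-trans z<s 1<T)
                              (trans va≡vb+1 (trans (cong vertexAt b+1≡T) returns))
    ...     | refl with joins-ends (edgeAt-joins b) (subst (λ z → Inc G z (vertexAt 1)) eq (edgeAt-inc⁺ 0))
    ...       | inj₂ v₁≡v_T = vertexAt-suc-≢ 0 (trans v₁≡v_T (trans (cong vertexAt b+1≡T) returns))
    ...       | inj₁ v₁≡v_b with distinct 1 b 1<T b<T v₁≡v_b
    ...         | refl = edgeAt-suc-≢ 0 (sym eq)

    edges-distinct : ∀ a b → a < T → b < T → edgeAt a ≡ edgeAt b → a ≡ b
    edges-distinct a b a<T b<T eq with <-cmp a b
    ... | tri< a<b _ _ = ⊥-elim (no-edge-repeat a b a<b b<T eq)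
    ... | tri≈ _ a≡b _ = a≡b
    ... | tri> _ _ b<a = ⊥-elim (no-edge-repeat b a b<a a<T (sym eq))

    walk-backwards : ∀ M j → j ≤ M → walk (reverse (walk x₀ M)) j ≡ reverse (walk x₀ (M ∸ j))
    walk-backwards M zero _ = refl
    walk-backwards M (suc j) j<M = begin
      step (walk (reverse (walk x₀ M)) j)          ≡⟨ cong step (walk-backwards M j (<⇒≤ j<M)) ⟩
      step (reverse (walk x₀ (M ∸ j)))             ≡⟨ cong (step ∘ reverse ∘ walk x₀) (+-∸-assoc 1 j<M) ⟩
      step (reverse (step (walk x₀ (M ∸ suc j))))  ≡⟨ step-reverse-step _ (walk-valid x₀ valid₀ (M ∸ suc j)) ⟩
      reverse (walk x₀ (M ∸ suc j))                ∎
      where open ≡-Reasoning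

    -- A valid dart at vertex N₀ + 1 of the walk uses one of the two F-edges
    -- there, so its walk either follows this walk forwards or retraces it.
    -- a walk from vertex N₀ + 1 follows this walk forwards, or backwards for N₀ steps
    Rejoins : ℕ → Dart → Set
    Rejoins N₀ x₁ = (∀ t → walk x₁ t ≡ walk x₀ (t + suc N₀)) ⊎
                    (∀ t → t ≤ N₀ → proj₁ (walk x₁ t) ≡ vertexAt (suc N₀ ∸ t))

    rejoin : ∀ N₀ (x₁ : Dart) → Valid x₁ → proj₁ x₁ ≡ vertexAt (suc N₀) → Rejoins N₀ x₁
    rejoin N₀ (u , g) (ig , fg) refl with F-edges-after N₀ ig fg
    ... | inj₂ forward = inj₁ λ t → trans (cong (λ z → walk (u , z) t) forward) (walk-+ x₀ (suc N₀) t)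
    ... | inj₁ backward = inj₂ λ t t≤N₀ →
          trans (cong (λ z → proj₁ (walk (u , z) t)) backward)
                (trans (cong proj₁ (walk-backwards N₀ t t≤N₀)) (cong vertexAt (sym (+-∸-assoc 1 t≤N₀))))

  SameOrbit : Dart → Dart → Set
  SameOrbit x₀ x₁ = ∀ z → (Visits x₀ z → Visits x₁ z) × (Visits x₁ z → Visits x₀ z)

  module _ (x₀ : Dart) (valid₀ : Valid x₀) (x₁ : Dart) (valid₁ : Valid x₁) where
    open Orbit x₀ valid₀

    rejoined-walk-stays : ∀ s → proj₁ x₁ ≡ vertexAt s → ∀ t → Visits x₀ (proj₁ (walk x₁ t))
    rejoined-walk-stays s x₁-at-s t = by-direction (rejoin N₀ x₁ valid₁ (trans x₁-at-s (sym at-N₀+1)))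
      where
      -- vertex N₀ + 1 is vertex s, t periods later, so that t ≤ N₀
      N₀ : ℕ
      N₀ = t * T + (s + (T ∸ 1))
      at-N₀+1 : vertexAt (suc N₀) ≡ vertexAt s
      at-N₀+1 = trans (cong vertexAt (N₀+1≡ t (T ∸ 1) s)) (cong proj₁ (walk-periodic (suc t) s))
        where
        N₀+1≡ : ∀ t u s → suc (t * suc u + (s + u)) ≡ s + suc t * suc u
        N₀+1≡ = solve-∀
      by-direction : Rejoins N₀ x₁ → Visits x₀ (proj₁ (walk x₁ t))
      by-direction (inj₁ forward) = t + suc N₀ , sym (cong proj₁ (forward t))
      by-direction (inj₂ backward) = suc N₀ ∸ t , sym (backward t (≤-trans (m≤m*n t T) (m≤m+n (t * T) (s + (T ∸ 1)))))

    rejoined-walk-meets-start : ∀ s → proj₁ x₁ ≡ vertexAt s → Visits x₁ (proj₁ x₀)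
    rejoined-walk-meets-start s x₁-at-s = by-direction (rejoin N₀ x₁ valid₁ (trans x₁-at-s (sym at-N₀+1)))
      where
      -- vertex N₀ + 1 is vertex s, one period later
      N₀ : ℕ
      N₀ = s + (T ∸ 1)
      at-N₀+1 : vertexAt (suc N₀) ≡ vertexAt s
      at-N₀+1 = trans (cong vertexAt (one-period s (T ∸ 1))) (cong proj₁ (walk-periodic 1 s))
        where
        one-period : ∀ s u → suc (s + u) ≡ s + 1 * suc u
        one-period = solve-∀
      by-direction : Rejoins N₀ x₁ → Visits x₁ (proj₁ x₀)
      by-direction (inj₁ forward) = s * (T ∸ 1) , trans (cong proj₁ (forward (s * (T ∸ 1))))
        (trans (cong vertexAt (after-s-periods s (T ∸ 1))) (cong proj₁ (walk-periodic (suc s) 0)))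
        where
        after-s-periods : ∀ s u → s * u + suc (s + u) ≡ 0 + suc s * suc u
        after-s-periods = solve-∀
      by-direction (inj₂ backward) = s , trans (backward s (m≤m+n s (T ∸ 1)))
        (trans (cong vertexAt (trans (cong (_∸ s) (sym (+-suc s (T ∸ 1)))) (m+n∸m≡n s T))) returns)

  visits-early : ∀ x (valid : Valid x) z → Visits x z → ∃ λ t → t < n × proj₁ (walk x t) ≡ z
  visits-early x valid z (t , eq) = t % T , <-≤-trans (m%n<n t T) T≤n , trans (cong proj₁ (sym (walk-mod t))) eq
    where open Orbit x valid

  same-orbit : ∀ x₀ (valid₀ : Valid x₀) x₁ (valid₁ : Valid x₁) s →
               proj₁ x₁ ≡ proj₁ (walk x₀ s) → SameOrbit x₀ x₁
  same-orbit x₀ valid₀ x₁ valid₁ s x₁-at-s z = forth , back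
    where
    back : Visits x₁ z → Visits x₀ z
    back (t , eq) = subst (Visits x₀) eq (rejoined-walk-stays x₀ valid₀ x₁ valid₁ s x₁-at-s t)
    forth : Visits x₀ z → Visits x₁ z
    forth (t , eq) with rejoined-walk-meets-start x₀ valid₀ x₁ valid₁ s x₁-at-s
    ... | (s′ , x₀-at-s′) = subst (Visits x₁) eq (rejoined-walk-stays x₁ valid₁ x₀ valid₀ s′ (sym x₀-at-s′) t)

  -- The root of a walk: the least vertex it visits.  Walks with the same
  -- orbit have the same root, so the root names a cycle of F canonically.
  abstract
    root : Dart → Fin n
    root x = minimum (λ t → proj₁ (walk x t)) n

    root-visited : ∀ x → Visits x (root x)
    root-visited x = proj₁ (minimum-attained _ n) , sym (proj₂ (minimum-attained _ n))

    root-least : ∀ x (valid : Valid x) z → Visits x z → toℕ (root x) ≤ toℕ z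
    root-least x valid z visits with visits-early x valid z visits
    ... | (t , t<n , eq) = subst (λ w → toℕ (root x) ≤ toℕ w) eq (minimum-≤ _ n t (<⇒≤ t<n))

  root-invariant : ∀ x₀ (valid₀ : Valid x₀) x₁ (valid₁ : Valid x₁) → SameOrbit x₀ x₁ → root x₀ ≡ root x₁
  root-invariant x₀ valid₀ x₁ valid₁ same = toℕ-injective (≤-antisym
    (root-least x₀ valid₀ (root x₁) (proj₂ (same (root x₁)) (root-visited x₁)))
    (root-least x₁ valid₁ (root x₀) (proj₁ (same (root x₀)) (root-visited x₀))))

  dart : Fin n → Dart
  dart v = v , f₁ v

  dart-valid : ∀ v → Valid (dart v)
  dart-valid v = f₁-inc v , f₁-F v

  root-of : Fin n → Fin n
  root-of v = root (dart v)

  root-walk-visits : ∀ v → Visits (dart (root-of v)) v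
  root-walk-visits v = proj₁ (same-orbit (dart v) (dart-valid v) (dart r) (dart-valid r)
                         (proj₁ (root-visited (dart v))) (sym (proj₂ (root-visited (dart v)))) v) (0 , refl)
    where
    r : Fin n
    r = root-of v

  root-of-F-edge : ∀ {e v} → Inc G e v → F e ≡ true → root-of (proj₁ (ends e)) ≡ root-of v
  root-of-F-edge {e} {v} ie fe = sym (root-invariant (dart v) (dart-valid v) (dart u) (dart-valid u)
                                   (same-orbit (dart v) (dart-valid v) (dart u) (dart-valid u) (proj₁ visits-u) (sym (proj₂ visits-u))))
    where
    u : Fin n
    u = proj₁ (ends e)
    visits-u : Visits (dart v) u
    visits-u with joins-ends (other-joins ie) (inj₁ refl)
    ... | inj₁ u≡v = 0 , sym u≡v
    ... | inj₂ u≡next = proj₂ (same-orbit (dart v) (dart-valid v) (v , e) (ie , fe) 0 refl u) (1 , sym u≡next)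

  abstract
    position : Dart → Fin m → ℕ
    position x e with least-below (λ t → proj₂ (walk x t) ≡ e) (λ t → proj₂ (walk x t) ≟ᶠ e) n
    ... | inj₁ (u , _) = u
    ... | inj₂ _ = 0

    position-edgeAt : ∀ x (valid : Valid x) a → a < Orbit.T x valid → position x (Orbit.edgeAt x valid a) ≡ a
    position-edgeAt x valid a a<T
      with least-below (λ t → proj₂ (walk x t) ≡ Orbit.edgeAt x valid a)
                       (λ t → proj₂ (walk x t) ≟ᶠ Orbit.edgeAt x valid a) n
    ... | inj₁ (u , u<n , found , least) with <-cmp u a
    ...   | tri< u<a _ _ = Orbit.edges-distinct x valid u a (<-trans u<a a<T) a<T found
    ...   | tri≈ _ u≡a _ = u≡a
    ...   | tri> _ _ a<u = ⊥-elim (least a a<u refl)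
    position-edgeAt x valid a a<T | inj₂ none = ⊥-elim (none a (<-≤-trans a<T (Orbit.T≤n x valid)) refl)

  cycle-of : ∀ y → Valid y → CycleIn G F
  cycle-of y valid = record
    { len = T ; len≥2 = 1<T ; vtx = vertexAt ∘ toℕ ; edg = edgeAt ∘ toℕ
    ; vtx-inj = λ {i} {j} eq → toℕ-injective (distinct _ _ (toℕ<n i) (toℕ<n j) eq)
    ; edg-inj = λ {i} {j} eq → toℕ-injective (edges-distinct _ _ (toℕ<n i) (toℕ<n j) eq)
    ; joins = λ i → subst (Joins G (edgeAt (toℕ i)) (vertexAt (toℕ i))) (next-vertex i) (edgeAt-joins (toℕ i))
    ; inF = edgeAt-F ∘ toℕ }
    where
    open Orbit y valid
    next-vertex : ∀ (i : Fin T) → vertexAt (suc (toℕ i)) ≡ vertexAt (toℕ (next G i))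
    next-vertex i = trans (cong proj₁ (walk-mod (suc (toℕ i)))) (cong vertexAt (sym (toℕ-fromℕ< (m%n<n (suc (toℕ i)) T))))

  F-edges-separated : ∀ {A : Set} (h : Fin m → A) {v a b} → a ≢ b →
    (a ≡ f₁ v ⊎ a ≡ f₂ v) → (b ≡ f₁ v ⊎ b ≡ f₂ v) → h a ≢ h b → h (f₁ v) ≢ h (f₂ v)
  F-edges-separated h a≢b (inj₁ refl) (inj₁ refl) _ = ⊥-elim (a≢b refl)
  F-edges-separated h a≢b (inj₂ refl) (inj₂ refl) _ = ⊥-elim (a≢b refl)
  F-edges-separated h a≢b (inj₁ refl) (inj₂ refl) ha≢hb = ha≢hb
  F-edges-separated h a≢b (inj₂ refl) (inj₁ refl) ha≢hb = ha≢hb ∘ sym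

  module _ (y : Dart) (valid : Valid y) where
    open Orbit y valid

    entered-and-left : ∀ {v} k → vertexAt (suc k) ≡ v →
      parity (position y (edgeAt k)) ≢ parity (position y (edgeAt (suc k))) →
      parity (position y (f₁ v)) ≢ parity (position y (f₂ v))
    entered-and-left k at-k+1 = F-edges-separated (parity ∘ position y) (edgeAt-suc-≢ k ∘ sym)
      (F-edge-at (subst (Inc G (edgeAt k)) at-k+1 (edgeAt-inc⁺ k)) (edgeAt-F k))
      (F-edge-at (subst (Inc G (edgeAt (suc k))) at-k+1 (edgeAt-inc (suc k))) (edgeAt-F (suc k)))

    even-cycle-alternates : ∀ v s → s < T → vertexAt s ≡ v → parity T ≡ 0ℙ →
      parity (position y (f₁ v)) ≢ parity (position y (f₂ v))
    even-cycle-alternates v (suc s) s+1<T at-s+1 _ = entered-and-left s at-s+1 λ same →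
      parity-suc-≢ s (trans (cong parity (sym (position-edgeAt y valid s (<-trans (n<1+n s) s+1<T))))
                     (trans same (cong parity (position-edgeAt y valid (suc s) s+1<T))))
    even-cycle-alternates v zero _ at-0 T-even = entered-and-left (T ∸ 1) (trans returns at-0) λ same →
      0ℙ≢1ℙ (sym (begin
        1ℙ                                  ≡⟨ sym (trans (sym (suc-homo-⁻¹ (T ∸ 1))) (cong _⁻¹ T-even)) ⟩
        parity (T ∸ 1)                      ≡⟨ cong parity (sym (position-edgeAt y valid (T ∸ 1) ≤-refl)) ⟩
        parity (position y (edgeAt (T ∸ 1))) ≡⟨ same ⟩
        parity (position y (edgeAt T))      ≡⟨ cong (parity ∘ position y) edge-returns ⟩
        parity (position y (edgeAt 0))      ≡⟨ cong parity (position-edgeAt y valid 0 (<-trans z<s 1<T)) ⟩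
        0ℙ                                  ∎))
      where open ≡-Reasoning

  -- A colouring of the F-edges: the parity of an edge's position along the
  -- walk from the root of its cycle.  It is proper on every even cycle.
  colour : Fin m → Parity
  colour e = parity (position (dart (root-of (proj₁ (ends e)))) e)

  colour-at : ∀ {e v} → Inc G e v → F e ≡ true → colour e ≡ parity (position (dart (root-of v)) e)
  colour-at {e} ie fe = cong (λ r → parity (position (dart r) e)) (root-of-F-edge ie fe)

  module _ (Exempt : Fin n → Set)
           (odd-exempt : ∀ (Z : CycleIn G F) → OddCycle G Z → ∀ v → OnCycle G v Z → Exempt v) where

    even-period : ∀ y (valid : Valid y) v → Visits y v → ¬ Exempt v → parity (Orbit.T y valid) ≡ 0ℙ
    even-period y valid v (t , at-t) not-exempt = by-parity (even-or-odd T)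
      where
      open Orbit y valid
      by-parity : parity T ≡ 0ℙ ⊎ Odd T → parity T ≡ 0ℙ
      by-parity (inj₁ even) = even
      by-parity (inj₂ odd) = ⊥-elim (not-exempt (odd-exempt (cycle-of y valid) odd v (fromℕ< (m%n<n t T) ,
        trans (cong vertexAt (toℕ-fromℕ< (m%n<n t T))) (trans (cong proj₁ (sym (walk-mod t))) at-t))))

    colour-proper : ∀ v → ¬ Exempt v → colour (f₁ v) ≢ colour (f₂ v)
    colour-proper v not-exempt same =
      even-cycle-alternates y valid v (t % T) (m%n<n t T) at-t%T (even-period y valid v visits not-exempt)
        (trans (sym (colour-at (f₁-inc v) (f₁-F v))) (trans same (colour-at (f₂-inc v) (f₂-F v))))
      where
      y : Dart
      y = dart (root-of v)
      valid : Valid y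
      valid = dart-valid (root-of v)
      open Orbit y valid
      visits : Visits y v
      visits = root-walk-visits v
      t : ℕ
      t = proj₁ visits
      at-t%T : vertexAt (t % T) ≡ v
      at-t%T = trans (cong proj₁ (sym (walk-mod t))) (proj₂ visits)

MatchedOnce : (G : Graph) → EdgeSet G → Fin (Graph.n G) → Set
MatchedOnce G M v = Σ (Fin (Graph.m G)) λ e → Inc G e v × M e ≡ true × (∀ e' → Inc G e' v → M e' ≡ true → e' ≡ e)

F-apart : ∀ {A : Set} {F : A → Bool} {a b} → F a ≡ true → F b ≡ false → a ≢ b
F-apart Fa Fb refl with trans (sym Fa) Fb
... | ()

-- In a cubic graph the edges outside a 2-factor form a perfect matching:
-- of the three edges at v exactly two lie in F.
complement-perfect : (G : Graph) → Cubic G → (F : EdgeSet G) → TwoFactor G F →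
                     PerfectMatching G (not ∘ F)
complement-perfect G (loopless , cubic) F two-factor v with cubic v
... | (e₁ , e₂ , e₃ , e₁≢e₂ , e₁≢e₃ , e₂≢e₃ , i₁ , i₂ , i₃ , at-v) = non-F-edge
  where
  open TwoFactorWalk G loopless F two-factor

  matched : ∀ e → In3 e₁ e₂ e₃ e → Inc G e v → F e ≡ false → MatchedOnce G (not ∘ F) v
  matched e e∈ ie fe = e , ie , cong not fe , unique
    where
    unique : ∀ e' → Inc G e' v → not (F e') ≡ true → e' ≡ e
    unique e' ie' ne' = third-unique (at-v (f₁ v) (f₁-inc v)) (at-v (f₂ v) (f₂-inc v)) (at-v e' ie') e∈ (f₁≢f₂ v)
      (F-apart (f₁-F v) fe' ∘ sym) (F-apart (f₂-F v) fe' ∘ sym) (F-apart (f₁-F v) fe ∘ sym) (F-apart (f₂-F v) fe ∘ sym)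
      where
      fe' : F e' ≡ false
      fe' = not-injective ne'

  non-F-edge : MatchedOnce G (not ∘ F) v
  non-F-edge with F e₁ in F₁ | F e₂ in F₂ | F e₃ in F₃
  ... | false | _ | _ = matched e₁ (inj₁ refl) i₁ F₁
  ... | true | false | _ = matched e₂ (inj₂ (inj₁ refl)) i₂ F₂
  ... | true | true | false = matched e₃ (inj₂ (inj₂ refl)) i₃ F₃
  ... | true | true | true = ⊥-elim (no-three-in-two (F-edge-at i₁ F₁) (F-edge-at i₂ F₂) (F-edge-at i₃ F₃) e₁≢e₂ e₁≢e₃ e₂≢e₃)

from-does : ∀ {P : Set} (d : Dec P) → does d ≡ true → P
from-does (yes p) _ = p
from-does (no _) ()

module GoodPairs (G : Graph) (cubic : Cubic G) (F : EdgeSet G) (two-factor : TwoFactor G F)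
         (k : ℕ) (C D : Fin k → CycleIn G F) (good : ∀ i → GoodPair G (C i) (D i))
         (disjoint-CC : ∀ i j → i ≢ j → VertexDisjoint G (C i) (C j))
         (disjoint-DD : ∀ i j → i ≢ j → VertexDisjoint G (D i) (D j))
         (disjoint-CD : ∀ i j → VertexDisjoint G (C i) (D j))
         (odd-covered : ∀ (Z : CycleIn G F) → OddCycle G Z → ∀ v → OnCycle G v Z →
                          ∃[ i ] (OnCycle G v (C i) ⊎ OnCycle G v (D i))) where
  open Graph G
  open Incidence G (proj₁ cubic)
  open TwoFactorWalk G (proj₁ cubic) F two-factor
  open Cyclic G

  Side : Set
  Side = Fin k × Bool

  Cyc : Side → CycleIn G F
  Cyc (i , true) = C i
  Cyc (i , false) = D i

  Paired : Fin n → Set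
  Paired v = ∃[ i ] (OnCycle G v (C i) ⊎ OnCycle G v (D i))

  paired : ∀ c {v} → OnCycle G v (Cyc c) → Paired v
  paired (i , true) on = i , inj₁ on
  paired (i , false) on = i , inj₂ on

  paired-on : ∀ {v} → Paired v → ∃ λ c → OnCycle G v (Cyc c)
  paired-on (i , inj₁ on) = (i , true) , on
  paired-on (i , inj₂ on) = (i , false) , on

  same-cycle : ∀ c c' {v} → OnCycle G v (Cyc c) → OnCycle G v (Cyc c') → c ≡ c'
  same-cycle (i , b) (j , b') {v} on on' with i ≟ᶠ j
  same-cycle (i , true)  (j , true)  on on' | yes refl = refl
  same-cycle (i , false) (j , false) on on' | yes refl = refl
  same-cycle (i , true)  (j , false) on on' | yes refl = ⊥-elim (disjoint-CD i i _ on on')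
  same-cycle (i , false) (j , true)  on on' | yes refl = ⊥-elim (disjoint-CD i i _ on' on)
  same-cycle (i , true)  (j , true)  on on' | no i≢j = ⊥-elim (disjoint-CC i j i≢j _ on on')
  same-cycle (i , false) (j , false) on on' | no i≢j = ⊥-elim (disjoint-DD i j i≢j _ on on')
  same-cycle (i , true)  (j , false) on on' | no _ = ⊥-elim (disjoint-CD i j _ on on')
  same-cycle (i , false) (j , true)  on on' | no _ = ⊥-elim (disjoint-CD j i _ on' on)

  on-cycle? : ∀ v (Z : CycleIn G F) → Dec (OnCycle G v Z)
  on-cycle? v Z = any? (λ i → vtx Z i ≟ᶠ v)

  paired? : ∀ v → Dec (Paired v)
  paired? v = any? (λ i → on-cycle? v (C i) ⊎-dec on-cycle? v (D i))

  some-side? : {P : Side → Set} → (∀ c → Dec (P c)) → Dec (∃ P)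
  some-side? {P} P? = map′ to from (any? (λ i → P? (i , true) ⊎-dec P? (i , false)))
    where
    to : (∃ λ i → P (i , true) ⊎ P (i , false)) → ∃ P
    to (i , inj₁ x) = (i , true) , x
    to (i , inj₂ x) = (i , false) , x
    from : ∃ P → (∃ λ i → P (i , true) ⊎ P (i , false))
    from ((i , true) , x) = i , inj₁ x
    from ((i , false) , x) = i , inj₂ x

  cycle-edge-inc : ∀ c t → Inc G (edg (Cyc c) t) (vtx (Cyc c) t)
  cycle-edge-inc c t = joins-inc₁ (joins (Cyc c) t)

  cycle-edge-inc-prev : ∀ c s → Inc G (edg (Cyc c) (prev s)) (vtx (Cyc c) s)
  cycle-edge-inc-prev c s = subst (Inc G (edg (Cyc c) (prev s)) ∘ vtx (Cyc c)) (next-prev s)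
                              (joins-inc₂ (joins (Cyc c) (prev s)))

  F-edge-on-cycle : ∀ c s {e} → Inc G e (vtx (Cyc c) s) → F e ≡ true → e ≡ edg (Cyc c) s ⊎ e ≡ edg (Cyc c) (prev s)
  F-edge-on-cycle c s = F-edges-at (λ eq → prev≢ (len≥2 (Cyc c)) s (sym (edg-inj (Cyc c) eq)))
    (cycle-edge-inc c s) (inF (Cyc c) s) (cycle-edge-inc-prev c s) (inF (Cyc c) (prev s))

  cycle-edge-same-cycle : ∀ c s c' t → Inc G (edg (Cyc c') t) (vtx (Cyc c) s) → c' ≡ c
  cycle-edge-same-cycle c s c' t ie with joins-ends (joins (Cyc c') t) ie
  ... | inj₁ eq = same-cycle c' c (t , sym eq) (s , refl)
  ... | inj₂ eq = same-cycle c' c (next G t , sym eq) (s , refl)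

  cycle-edge-at : ∀ c s t → Inc G (edg (Cyc c) t) (vtx (Cyc c) s) → t ≡ s ⊎ t ≡ prev s
  cycle-edge-at c s t ie with joins-ends (joins (Cyc c) t) ie
  ... | inj₁ eq = inj₁ (sym (vtx-inj (Cyc c) eq))
  ... | inj₂ eq = inj₂ (trans (sym (prev-next t)) (cong prev (sym (vtx-inj (Cyc c) eq))))

  cycle-edge-ends-paired : ∀ c t {w} → Inc G (edg (Cyc c) t) w → Paired w
  cycle-edge-ends-paired c t ie with joins-ends (joins (Cyc c) t) ie
  ... | inj₁ eq = paired c (t , sym eq)
  ... | inj₂ eq = paired c (next G t , sym eq)

  F-edge-unpaired : ∀ {v e} → ¬ Paired v → Inc G e v → F e ≡ true → ¬ Paired (proj₁ (ends e))
  F-edge-unpaired {v} {e} unpaired ie fe p with paired-on p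
  ... | (c , s , eq) with F-edge-on-cycle c s (subst (Inc G e) (sym eq) (inj₁ refl)) fe
  ...   | inj₁ refl = unpaired (cycle-edge-ends-paired c s ie)
  ...   | inj₂ refl = unpaired (cycle-edge-ends-paired c (prev s) ie)

  F-edge-paired : ∀ c s e → Inc G e (vtx (Cyc c) s) → F e ≡ true → ¬ Paired (proj₁ (ends e)) → ⊥
  F-edge-paired c s e ie fe unpaired with F-edge-on-cycle c s ie fe
  ... | inj₁ refl = unpaired (cycle-edge-ends-paired c s (inj₁ refl))
  ... | inj₂ refl = unpaired (cycle-edge-ends-paired c (prev s) (inj₁ refl))

  record Rungs (i : Fin k) : Set where
    field
      rung : Fin 3 → Fin m
      foot : (b : Bool) → Fin 3 → Fin (len (Cyc (i , b)))
      rung-joins : ∀ j → Joins G (rung j) (vtx (C i) (foot true j)) (vtx (D i) (foot false j))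
      odd-arcs : ∀ b → OddArcs (len (Cyc (i , b))) (foot b (# 0)) (foot b (# 1)) (foot b (# 2))
      odd-length : ∀ b → OddCycle G (Cyc (i , b))

  rungs : ∀ i → Rungs i
  rungs i with good i
  ... | (oddC , oddD , _ , p , q , r , p' , q' , r' , ex , ey , ez ,
         _ , _ , _ , _ , _ , _ , _ , _ , _ , jx , jy , jz , arcsC , arcsD) = record
    { rung = λ { Fin.zero → ex ; (Fin.suc Fin.zero) → ey ; (Fin.suc (Fin.suc Fin.zero)) → ez }
    ; foot = λ { true  Fin.zero → p  ; true  (Fin.suc Fin.zero) → q  ; true  (Fin.suc (Fin.suc Fin.zero)) → r
               ; false Fin.zero → p' ; false (Fin.suc Fin.zero) → q' ; false (Fin.suc (Fin.suc Fin.zero)) → r' }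
    ; rung-joins = λ { Fin.zero → jx ; (Fin.suc Fin.zero) → jy ; (Fin.suc (Fin.suc Fin.zero)) → jz }
    ; odd-arcs = λ { true → arcsC ; false → arcsD }
    ; odd-length = λ { true → oddC ; false → oddD }
    }

  paired-cycle-odd : ∀ c → parity (len (Cyc c)) ≡ 1ℙ
  paired-cycle-odd (i , s) = odd⇒parity≡1ℙ (Rungs.odd-length (rungs i) s)

  module Matching (j : Fin 3) (b : Parity) where
    X : Fin k → Fin m
    X i = Rungs.rung (rungs i) j

    Foot : (c : Side) → Fin (len (Cyc c))
    Foot (i , s) = Rungs.foot (rungs i) s j

    X-inc : ∀ c → Inc G (X (proj₁ c)) (vtx (Cyc c) (Foot c))
    X-inc (i , true) = joins-inc₁ (Rungs.rung-joins (rungs i) j)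
    X-inc (i , false) = joins-inc₂ (Rungs.rung-joins (rungs i) j)

    X-at : ∀ i c s → Inc G (X i) (vtx (Cyc c) s) → proj₁ c ≡ i × s ≡ Foot c
    X-at i c s ie with joins-ends (Rungs.rung-joins (rungs i) j) ie
    ... | inj₁ eq with same-cycle c (i , true) (s , refl) (_ , sym eq)
    ...   | refl = refl , vtx-inj (C i) eq
    X-at i c s ie | inj₂ eq with same-cycle c (i , false) (s , refl) (_ , sym eq)
    ...   | refl = refl , vtx-inj (D i) eq

    X-ends-paired : ∀ i {w} → Inc G (X i) w → Paired w
    X-ends-paired i ie with joins-ends (Rungs.rung-joins (rungs i) j) ie
    ... | inj₁ eq = i , inj₁ (_ , sym eq)
    ... | inj₂ eq = i , inj₂ (_ , sym eq)

    Chosen : (c : Side) → Fin (len (Cyc c)) → Set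
    Chosen c t = parity (gap (len (Cyc c)) (toℕ (Foot c)) (toℕ t)) ≡ 1ℙ

    InN : Fin m → Set
    InN e = (∃ λ i → e ≡ X i) ⊎ (∃ λ c → ∃ λ t → e ≡ edg (Cyc c) t × Chosen c t) ⊎
            (F e ≡ true × ¬ Paired (proj₁ (ends e)) × colour e ≡ b)

    InN? : ∀ e → Dec (InN e)
    InN? e = any? (λ i → e ≟ᶠ X i) ⊎-dec
             some-side? (λ c → any? (λ t → (e ≟ᶠ edg (Cyc c) t) ×-dec (parity (gap (len (Cyc c)) (toℕ (Foot c)) (toℕ t)) ≟ℙ 1ℙ))) ⊎-dec
             ((F e ≟ᴮ true) ×-dec ¬? (paired? (proj₁ (ends e))) ×-dec (colour e ≟ℙ b))

    N : EdgeSet G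
    N e = does (InN? e)

    in-N : ∀ {e} → InN e → N e ≡ true
    in-N {e} = dec-true (InN? e)

    N-at-cycle : ∀ c s e → Inc G e (vtx (Cyc c) s) → N e ≡ true →
      (e ≡ X (proj₁ c) × s ≡ Foot c) ⊎ (e ≡ edg (Cyc c) s × Chosen c s) ⊎ (e ≡ edg (Cyc c) (prev s) × Chosen c (prev s))
    N-at-cycle c s e ie ne with from-does (InN? e) ne
    ... | inj₁ (i , refl) = let (c≡i , at-foot) = X-at i c s ie in inj₁ (cong X (sym c≡i) , at-foot)
    ... | inj₂ (inj₂ (fe , unpaired , _)) = ⊥-elim (F-edge-paired c s e ie fe unpaired)
    ... | inj₂ (inj₁ (c' , t , refl , chosen)) with cycle-edge-same-cycle c s c' t ie
    ...   | refl with cycle-edge-at c s t ie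
    ...     | inj₁ refl = inj₂ (inj₁ (refl , chosen))
    ...     | inj₂ refl = inj₂ (inj₂ (refl , chosen))

    N-at-unpaired : ∀ v e → ¬ Paired v → Inc G e v → N e ≡ true → F e ≡ true × colour e ≡ b
    N-at-unpaired v e unpaired ie ne with from-does (InN? e) ne
    ... | inj₁ (i , refl) = ⊥-elim (unpaired (X-ends-paired i ie))
    ... | inj₂ (inj₁ (c , t , refl , _)) = ⊥-elim (unpaired (cycle-edge-ends-paired c t ie))
    ... | inj₂ (inj₂ (fe , _ , colour-b)) = fe , colour-b

    matched-on-cycle : ∀ c s → MatchedOnce G N (vtx (Cyc c) s)
    matched-on-cycle c s with s ≟ᶠ Foot c
    ... | yes refl = X (proj₁ c) , X-inc c , in-N (inj₁ (proj₁ c , refl)) , only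
      where
      only : ∀ e → Inc G e (vtx (Cyc c) (Foot c)) → N e ≡ true → e ≡ X (proj₁ c)
      only e ie ne with N-at-cycle c (Foot c) e ie ne
      ... | inj₁ (e≡X , _) = e≡X
      ... | inj₂ (inj₁ (_ , chosen)) = ⊥-elim (0ℙ≢1ℙ (trans (sym (gap-self (len (Cyc c)) (toℕ (Foot c)))) chosen))
      ... | inj₂ (inj₂ (_ , chosen)) = ⊥-elim (0ℙ≢1ℙ (trans (sym (gap-to-prev (paired-cycle-odd c) (Foot c))) chosen))
    ... | no s≢foot with parity (gap (len (Cyc c)) (toℕ (Foot c)) (toℕ s)) in s-parity
    ...   | 1ℙ = edg (Cyc c) s , cycle-edge-inc c s , in-N (inj₂ (inj₁ (c , s , refl , s-parity))) , only
      where
      only : ∀ e → Inc G e (vtx (Cyc c) s) → N e ≡ true → e ≡ edg (Cyc c) s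
      only e ie ne with N-at-cycle c s e ie ne
      ... | inj₁ (_ , at-foot) = ⊥-elim (s≢foot at-foot)
      ... | inj₂ (inj₁ (e≡s , _)) = e≡s
      ... | inj₂ (inj₂ (_ , chosen)) = ⊥-elim (0ℙ≢1ℙ (trans (sym (trans (gap-prev s (Foot c) s≢foot) (cong _⁻¹ s-parity))) chosen))
    ...   | 0ℙ = edg (Cyc c) (prev s) , cycle-edge-inc-prev c s ,
                 in-N (inj₂ (inj₁ (c , prev s , refl , trans (gap-prev s (Foot c) s≢foot) (cong _⁻¹ s-parity)))) , only
      where
      only : ∀ e → Inc G e (vtx (Cyc c) s) → N e ≡ true → e ≡ edg (Cyc c) (prev s)
      only e ie ne with N-at-cycle c s e ie ne
      ... | inj₁ (_ , at-foot) = ⊥-elim (s≢foot at-foot)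
      ... | inj₂ (inj₁ (_ , chosen)) = ⊥-elim (0ℙ≢1ℙ (trans (sym s-parity) chosen))
      ... | inj₂ (inj₂ (e≡prev , _)) = e≡prev

    matched-unpaired : ∀ v → ¬ Paired v → MatchedOnce G N v
    matched-unpaired v unpaired = by-colour (colour (f₁ v) ≟ℙ b)
      where
      proper : colour (f₁ v) ≢ colour (f₂ v)
      proper = colour-proper Paired odd-covered v unpaired
      take : ∀ {e} → Inc G e v → F e ≡ true → colour e ≡ b →
             (∀ {e'} → e' ≡ f₁ v ⊎ e' ≡ f₂ v → colour e' ≡ b → e' ≡ e) → MatchedOnce G N v
      take {e} ie fe ce only = e , ie , in-N (inj₂ (inj₂ (fe , F-edge-unpaired unpaired ie fe , ce))) , λ e' ie' ne' →
        let (fe' , ce') = N-at-unpaired v e' unpaired ie' ne' in only (F-edge-at ie' fe') ce'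
      by-colour : Dec (colour (f₁ v) ≡ b) → MatchedOnce G N v
      by-colour (yes c₁≡b) = take (f₁-inc v) (f₁-F v) c₁≡b λ where
        (inj₁ e≡f₁) _ → e≡f₁
        (inj₂ refl) c₂≡b → ⊥-elim (proper (trans c₁≡b (sym c₂≡b)))
      by-colour (no c₁≢b) = take (f₂-inc v) (f₂-F v) (trans (≢⇒⁻¹ proper) (sym (≢⇒⁻¹ c₁≢b))) λ where
        (inj₁ refl) c₁≡b → ⊥-elim (c₁≢b c₁≡b)
        (inj₂ e≡f₂) _ → e≡f₂

    perfect : PerfectMatching G N
    perfect v with paired? v
    ... | no unpaired = matched-unpaired v unpaired
    ... | yes p with paired-on p
    ...   | (c , s , at) = subst (MatchedOnce G N) at (matched-on-cycle c s)

  -- The three matchings: colours 1ℙ, 0ℙ, 1ℙ on the unpaired cycles, so that the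
  -- first two already cover those.
  colour-for : Fin 3 → Parity
  colour-for Fin.zero = 1ℙ
  colour-for (Fin.suc Fin.zero) = 0ℙ
  colour-for (Fin.suc (Fin.suc Fin.zero)) = 1ℙ

  N : Fin 3 → EdgeSet G
  N j = Matching.N j (colour-for j)

  matchings : List (EdgeSet G)
  matchings = (not ∘ F) ∷ N (# 0) ∷ N (# 1) ∷ N (# 2) ∷ []

  in-matching : ∀ j {e} → Matching.InN j (colour-for j) e → Any (λ M → M e ≡ true) matchings
  in-matching Fin.zero x = there (here (Matching.in-N (# 0) 1ℙ x))
  in-matching (Fin.suc Fin.zero) x = there (there (here (Matching.in-N (# 1) 0ℙ x)))
  in-matching (Fin.suc (Fin.suc Fin.zero)) x = there (there (there (here (Matching.in-N (# 2) 1ℙ x))))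

  -- Every edge is covered: non-F edges by the complement of F, F-edges of
  -- unpaired cycles by colour, and edges of a paired cycle by the rung whose
  -- foot lies an odd distance behind them.
  covered : ∀ e → Any (λ M → M e ≡ true) matchings
  covered e with F e in fe
  ... | false = here (cong not fe)
  ... | true with paired? (proj₁ (ends e))
  ...   | no unpaired with colour e in ce
  ...     | 1ℙ = in-matching (# 0) (inj₂ (inj₂ (fe , unpaired , ce)))
  ...     | 0ℙ = in-matching (# 1) (inj₂ (inj₂ (fe , unpaired , ce)))
  covered e | true | yes p with paired-on p
  ...   | (c , s , at) = on-cycle (F-edge-on-cycle c s (subst (Inc G e) (sym at) (inj₁ refl)) fe)
    where
    chosen-by-some : ∀ t → e ≡ edg (Cyc c) t → Any (λ M → M e ≡ true) matchings
    chosen-by-some t e≡t with odd-gap _ (λ j → Matching.Foot j (colour-for j) c) (Rungs.odd-arcs (rungs (proj₁ c)) (proj₂ c)) t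
    ... | (j , odd) = in-matching j (inj₂ (inj₁ (c , t , e≡t , odd)))
    on-cycle : e ≡ edg (Cyc c) s ⊎ e ≡ edg (Cyc c) (prev s) → Any (λ M → M e ≡ true) matchings
    on-cycle (inj₁ e≡s) = chosen-by-some s e≡s
    on-cycle (inj₂ e≡prev) = chosen-by-some (prev s) e≡prev

  covering : CoveredBy≤4PM G
  covering = matchings , ≤-refl ,
    (complement-perfect G cubic F two-factor ∷ Matching.perfect (# 0) 1ℙ ∷ Matching.perfect (# 1) 0ℙ ∷ Matching.perfect (# 2) 1ℙ ∷ []) ,
    covered

theorem3p5 : (G : Graph) → Cubic G → (F : EdgeSet G) → TwoFactor G F →
    OddCyclesPairedGood G F → CoveredBy≤4PM G
theorem3p5 G cubic F two-factor (k , C , D , good , disjoint-CC , disjoint-DD , disjoint-CD , odd-covered) =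
  GoodPairs.covering G cubic F two-factor k C D good disjoint-CC disjoint-DD disjoint-CD odd-covered
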